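{- Let $M$ be a thread-register model and $\mathcal B$ a set of thread-local actions of $M$. A path $\pi$ of $M$ starting in the initial state of $M$ is $\mathcal B$-$\smile_A$-just if and only if (a) every action $a\notin\mathcal B$ that is thread-enabled by $\pi$ belongs to $\mathit{start}(r)$ for some $r\in\mathbb R$, and (b) if for some $r\in\mathbb R$ an action $a\in\mathit{start}(r)$ is thread-enabled by $\pi$, then $\pi$ contains infinitely many occurrences of actions from $\mathit{start}(r)$.
   Context: An LTS is a tuple $(S,\mathit{Act},\mathit{init},\mathit{Trans})$ with finite $S$, finite $\mathit{Act}$, $\mathit{init}\in S$, $\mathit{Trans}\subseteq S\times\mathit{Act}\times S$; $a$ is enabled in $s$ if $(s,a,s')\in\mathit{Trans}$ for some $s'$. A path is a nonempty finite or infinite alternating sequence $s_0a_1s_1a_2\ldots$ with $(s_i,a_{i+1},s_{i+1})\in\mathit{Trans}$, ending in a state if finite; a suffix of a path is a path obtained by removing an initial segment ending in a state. The parallel composition of LTSs $P_i=(S_i,\mathit{Act}_i,\mathit{init}_i,\mathit{Trans}_i)$, $i=1..k$, has states $S_1\times\cdots\times S_k$, actions $\bigcup_i\mathit{Act}_i$, initial state $(\mathit{init}_i)_i$, and a transition $((s_i)_i,a,(s'_i)_i)$ iff for every $i$: $s'_i=s_i$ if $a\notin\mathit{Act}_i$, and $(s_i,a,s'_i)\in\mathit{Trans}_i$ if $a\in\mathit{Act}_i$. Registers. Fix disjoint finite sets $\mathbb T$ (thread ids) and $\mathbb R$ (register ids); each $r\in\mathbb R$ has a finite domain $D_r$ and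 initial value $d^0_r$. For $t\in\mathbb T$, $r\in\mathbb R$, $d\in D_r$ the register actions are $\mathit{sr}_{t,r}$, $\mathit{fr}_{t,r}(d)$, $\mathit{sw}_{t,r}(d)$, $\mathit{fw}_{t,r}$ (interface) and $\mathit{or}_{t,r}$, $\mathit{ow}_{t,r}$ (register-local). $\mathit{start}(r)$ is the set of all actions $\mathit{sr}_{t,r}$ and $\mathit{sw}_{t,r}(d)$ with $t\in\mathbb T$, $d\in D_r$. States of a register LTS for $r$ are statuses $s$ with components $\mathit{stor}(s)\in D_r$, $\mathit{rds}(s),\mathit{wrts}(s),\mathit{pend}(s)\subseteq\mathbb T$, and per $t$: $\mathit{rec}(s,t)\in D_r$, $\mathit{ovrl}(s,t)\in\{\mathit{true},\mathit{false}\}$, $\mathit{posv}(s,t)\subseteq D_r$; initially $\mathit{stor}=d^0_r$, $\mathit{rds}=\mathit{wrts}=\mathit{pend}=\emptyset$, $\mathit{rec}(t)=d^0_r$, $\mathit{ovrl}(t)=\mathit{false}$, $\mathit{posv}(t)=\emptyset$. Updates (unmentioned components unchanged, right sides evaluated in $s$): $\mathit{usr}(s,t)$: add $t$ to $\mathit{rds},\mathit{pend}$; $\mathit{ovrl}(t):=(\mathit{wrts}(s)\neq\emptyset)$; $\mathit{posv}(t):=\{\mathit{stor}(s)\}\cup\{\mathit{rec}(s,t'):t'\in\mathit{wrts}(s)\}$. $\mathit{ufr}(s,t)$: remove $t$ from $\mathit{rds}$. $\mathit{usw}(s,t,d)$: add $t$ to $\mathit{wrts},\mathit{pend}$; $\mathit{rec}(t):=d$;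 $\mathit{ovrl}(t):=(\mathit{wrts}(s)\neq\emptyset)$; for all $t'\neq t$: $\mathit{ovrl}(t'):=\mathit{true}$, $\mathit{posv}(t'):=\mathit{posv}(s,t')\cup\{d\}$. $\mathit{ufw}(s,t,d)$: $\mathit{stor}:=d$, remove $t$ from $\mathit{wrts}$. $\mathit{uor}(s,t)$: remove $t$ from $\mathit{pend}$, $\mathit{rec}(t):=\mathit{stor}(s)$. $\mathit{uow}(s,t,d)$: $\mathit{stor}:=d$, remove $t$ from $\mathit{pend}$. In each register LTS, for all $s,t,d$: if $t\notin\mathit{rds}(s)\cup\mathit{wrts}(s)$, transitions $s\xrightarrow{\mathit{sr}_{t,r}}\mathit{usr}(s,t)$ and $s\xrightarrow{\mathit{sw}_{t,r}(d)}\mathit{usw}(s,t,d)$; further: Safe: $t\in\mathit{rds}(s)$, $\neg\mathit{ovrl}(s,t)$: $\mathit{fr}_{t,r}(\mathit{stor}(s))$ to $\mathit{ufr}(s,t)$; $t\in\mathit{rds}(s)$, $\mathit{ovrl}(s,t)$: $\mathit{fr}_{t,r}(d)$ to $\mathit{ufr}(s,t)$; $t\in\mathit{wrts}(s)$, $\neg\mathit{ovrl}(s,t)$: $\mathit{fw}_{t,r}$ to $\mathit{ufw}(s,t,\mathit{rec}(s,t))$; $t\in\mathit{wrts}(s)$, $\mathit{ovrl}(s,t)$: $\mathit{fw}_{t,r}$ to $\mathit{ufw}(s,t,d)$. Regular: $t\in\mathit{rds}(s)$, $d\in\mathit{posv}(s,t)$: $\mathit{fr}_{t,r}(d)$ to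 $\mathit{ufr}(s,t)$; $t\in\mathit{wrts}(s)\cap\mathit{pend}(s)$: $\mathit{ow}_{t,r}$ to $\mathit{uow}(s,t,\mathit{rec}(s,t))$; $t\in\mathit{wrts}(s)\setminus\mathit{pend}(s)$: $\mathit{fw}_{t,r}$ to $\mathit{ufw}(s,t,\mathit{stor}(s))$. Atomic: $t\in\mathit{rds}(s)\cap\mathit{pend}(s)$: $\mathit{or}_{t,r}$ to $\mathit{uor}(s,t)$; $t\in\mathit{wrts}(s)\cap\mathit{pend}(s)$: $\mathit{ow}_{t,r}$ to $\mathit{uow}(s,t,\mathit{rec}(s,t))$; $t\in\mathit{rds}(s)\setminus\mathit{pend}(s)$: $\mathit{fr}_{t,r}(\mathit{rec}(s,t))$ to $\mathit{ufr}(s,t)$; $t\in\mathit{wrts}(s)\setminus\mathit{pend}(s)$: $\mathit{fw}_{t,r}$ to $\mathit{ufw}(s,t,\mathit{stor}(s))$. Threads. Each $t\in\mathbb T$ has a thread LTS $T_t$ with actions $\{\mathit{sr}_{t,r},\mathit{fr}_{t,r}(d),\mathit{sw}_{t,r}(d),\mathit{fw}_{t,r}:r\in\mathbb R,d\in D_r\}\cup\mathit{TLoc}_t$, the thread-local sets $\mathit{TLoc}_t$ pairwise disjoint and disjoint from register actions; on every path from its initial state, each $\mathit{sr}_{t,r}$-transition leads to a state where exactly the $\mathit{fr}_{t,r}(d)$, $d\in D_r$, are enabled, each $\mathit{sw}_{t,r}(d)$-transition leads to a state where only $\mathit{fw}_{t,r}$ is enabled, and $\mathit{fr}_{t,r}(d)$,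 $\mathit{fw}_{t,r}$ are enabled only in such states. A thread-register model $M$ is the parallel composition of all $T_t$ and one safe, regular or atomic register LTS per $r\in\mathbb R$; $\mathit{thr}(a)=t$ for every action indexed by $t$ (thread-local actions of $\mathit{TLoc}_t$ included), $\mathit{reg}(a)=r$ for register actions of $r$, $\mathit{reg}(a)=\bot$ for thread-local actions. Justness. $\mathit{sr?}(a)$ iff $a=\mathit{sr}_{t,r}$ for some $t,r$; $\mathit{sw?}(a)$ iff $a=\mathit{sw}_{t,r}(d)$ for some $t,r,d$. $\smile_T=\{(a,b):\mathit{thr}(a)\neq\mathit{thr}(b)\}$, $\smile_S=\smile_T\setminus\{(a,b):(\mathit{sr?}(a)\lor\mathit{sw?}(a))\wedge\mathit{sw?}(b)\wedge\mathit{reg}(a)=\mathit{reg}(b)\}$, $\smile_I=\smile_S\setminus\{(a,b):\mathit{sw?}(a)\wedge\mathit{sr?}(b)\wedge\mathit{reg}(a)=\mathit{reg}(b)\}$, $\smile_A=\smile_I\setminus\{(a,b):\mathit{sr?}(a)\wedge\mathit{sr?}(b)\wedge\mathit{reg}(a)=\mathit{reg}(b)\}$. A path $\pi$ is $\mathcal B$-$\smile$-just if for every suffix $\pi'$ of $\pi$ and every action $a\notin\mathcal B$ enabled in the first state of $\pi'$, some action $b$ with $\neg(a\smile b)$ occurs in $\pi'$. Thread-enabling. For a path $\pi$ of $M$ from its initial state and $t\in\mathbb T$, if $\pi$ has a suffix on which no action $b$ with $\mathit{thr}(b)=t$ occurs, the $T_t$-component of all states on that suffix is one state $\mathit{end}_t(\pi)$.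 An action $a$ is thread-enabled by $\pi$ if, for $t=\mathit{thr}(a)$, $\pi$ contains only finitely many actions $b$ with $\mathit{thr}(b)=t$ and $a$ is enabled in $\mathit{end}_t(\pi)$ in $T_t$. -}

module Defs where

open import Data.Nat using (ℕ; zero; suc; _≤_; _<_)
open import Data.Fin using (Fin; _≟_)
import Data.Fin as F
open import Data.Bool using (Bool; true; false; _∨_; _∧_; not; if_then_else_)
open import Data.Maybe using (Maybe; just; nothing)
open import Data.Vec using (Vec; lookup; _[_]≔_; tabulate; replicate)
open import Data.Product using (Σ; ∃; ∃-syntax; _×_; _,_)
open import Data.Sum using (_⊎_)
open import Data.Unit using (⊤)
open import Data.Empty using (⊥)
open import Function using (_∘_)
open import Relation.Nullary using (¬_)
open import Relation.Nullary.Decidable using (⌊_⌋)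
open import Relation.Binary.PropositionalEquality using (_≡_; _≢_)

-- Signature: thread ids 𝕋 = Fin nT, register ids ℝ = Fin nR,
-- domains D_r = Fin (dom r) with initial value d0 r,
-- thread-local action sets TLoc_t = Fin (nLoc t) (tagged by t, hence
-- pairwise disjoint and disjoint from register actions).

record Sig : Set where
  field
    nT nR : ℕ
    dom   : Fin nR → ℕ
    d0    : (r : Fin nR) → Fin (dom r)
    nLoc  : Fin nT → ℕ

module _ (σ : Sig) where
  open Sig σ

  Thr : Set
  Thr = Fin nT

  Reg : Set
  Reg = Fin nR

  Dom : Reg → Set
  Dom r = Fin (dom r)

  data Action : Set where
    sr  : Thr → (r : Reg) → Action
    fr  : Thr → (r : Reg) → Dom r → Action
    sw  : Thr → (r : Reg) → Dom r → Action
    fw  : Thr → Reg → Action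
    or  : Thr → Reg → Action
    ow  : Thr → Reg → Action
    loc : (t : Thr) → Fin (nLoc t) → Action

module _ {σ : Sig} where
  open Sig σ

  thr : Action σ → Thr σ
  thr (sr t _)    = t
  thr (fr t _ _)  = t
  thr (sw t _ _)  = t
  thr (fw t _)    = t
  thr (or t _)    = t
  thr (ow t _)    = t
  thr (loc t _)   = t

  -- reg(a), with ⊥ rendered as nothing
  reg : Action σ → Maybe (Reg σ)
  reg (sr _ r)    = just r
  reg (fr _ r _)  = just r
  reg (sw _ r _)  = just r
  reg (fw _ r)    = just r
  reg (or _ r)    = just r
  reg (ow _ r)    = just r
  reg (loc _ _)   = nothing

  IsSR : Action σ → Set
  IsSR (sr _ _) = ⊤
  IsSR _        = ⊥

  IsSW : Action σ → Set
  IsSW (sw _ _ _) = ⊤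
  IsSW _          = ⊥

  IsLocal : Action σ → Set
  IsLocal (loc _ _) = ⊤
  IsLocal _         = ⊥

  data InStart (r : Reg σ) : Action σ → Set where
    start-sr : (t : Thr σ) → InStart r (sr t r)
    start-sw : (t : Thr σ) (d : Dom σ r) → InStart r (sw t r d)

  _⌣T_ : Action σ → Action σ → Set
  a ⌣T b = thr a ≢ thr b

  _⌣S_ : Action σ → Action σ → Set
  a ⌣S b = (a ⌣T b) × ¬ ((IsSR a ⊎ IsSW a) × IsSW b × reg a ≡ reg b)

  _⌣I_ : Action σ → Action σ → Set
  a ⌣I b = (a ⌣S b) × ¬ (IsSW a × IsSR b × reg a ≡ reg b)

  _⌣A_ : Action σ → Action σ → Set
  a ⌣A b = (a ⌣I b) × ¬ (IsSR a × IsSR b × reg a ≡ reg b)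

  InTAct : Thr σ → Action σ → Set
  InTAct t (sr t' _)   = t' ≡ t
  InTAct t (fr t' _ _) = t' ≡ t
  InTAct t (sw t' _ _) = t' ≡ t
  InTAct t (fw t' _)   = t' ≡ t
  InTAct t (or _ _)    = ⊥
  InTAct t (ow _ _)    = ⊥
  InTAct t (loc t' _)  = t' ≡ t

record ThreadLTS (σ : Sig) (t : Thr σ) : Set₁ where
  field
    nS    : ℕ
    init  : Fin nS
    Trans : Fin nS → Action σ → Fin nS → Set
    trans-act : ∀ {s a s'} → Trans s a s' → InTAct t a

  Enabled : Action σ → Fin nS → Set
  Enabled a s = ∃[ s' ] Trans s a s'

  data Reach : Fin nS → Set where
    reach-init : Reach init
    reach-step : ∀ {s a s'} → Reach s → Trans s a s' → Reach s'

-- The well-formedness condition on thread LTSs ("on every path from its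
-- initial state ..."), expressed stepwise along reachable transitions.
record WFThread {σ : Sig} {t : Thr σ} (T : ThreadLTS σ t) : Set where
  open ThreadLTS T
  field
    after-sr : ∀ {s s'} r → Reach s → Trans s (sr t r) s' →
               ∀ a → (Enabled a s' → ∃[ d ] a ≡ fr t r d)
                   × ((d : Dom σ r) → a ≡ fr t r d → Enabled a s')
    after-sw : ∀ {s s'} r d → Reach s → Trans s (sw t r d) s' →
               ∀ a → (Enabled a s' → a ≡ fw t r) × (a ≡ fw t r → Enabled a s')
    fr-init  : ∀ r d → ¬ Enabled (fr t r d) init
    fr-only  : ∀ {s b s'} r d → Reach s → Trans s b s' →
               Enabled (fr t r d) s' → b ≡ sr t r
    fw-init  : ∀ r → ¬ Enabled (fw t r) init
    fw-only  : ∀ {s b s'} r → Reach s → Trans s b s' →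
               Enabled (fw t r) s' → ∃[ d ] b ≡ sw t r d

data Kind : Set where
  safe regular atomic : Kind

anyF : ∀ {n} → (Fin n → Bool) → Bool
anyF {zero}  f = false
anyF {suc n} f = f F.zero ∨ anyF (f ∘ F.suc)

Subset : ℕ → Set
Subset n = Vec Bool n

nonEmpty : ∀ {n} → Subset n → Bool
nonEmpty p = anyF (lookup p)

_∪_ : ∀ {n} → Subset n → Subset n → Subset n
p ∪ q = tabulate (λ i → lookup p i ∨ lookup q i)

⁅_⁆ : ∀ {n} → Fin n → Subset n
⁅ i ⁆ = tabulate (λ j → ⌊ j ≟ i ⌋)

module _ (σ : Sig) where
  open Sig σ

  record Status (r : Reg σ) : Set where
    field
      stor : Dom σ r
      rds wrts pend : Subset nT
      rec  : Vec (Dom σ r) nT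
      ovrl : Vec Bool nT
      posv : Vec (Subset (dom r)) nT

open Status public

module _ {σ : Sig} where
  open Sig σ

  initStatus : (r : Reg σ) → Status σ r
  initStatus r = record
    { stor = d0 r ; rds = replicate nT false ; wrts = replicate nT false
    ; pend = replicate nT false ; rec = replicate nT (d0 r)
    ; ovrl = replicate nT false ; posv = replicate nT (replicate (dom r) false) }

  module _ {r : Reg σ} where
    recOfWriters : Status σ r → Subset (dom r)
    recOfWriters s =
      tabulate (λ d → anyF (λ t' → lookup (wrts s) t' ∧ ⌊ lookup (rec s) t' ≟ d ⌋))

    usr : Status σ r → Thr σ → Status σ r
    usr s t = record s
      { rds  = rds s [ t ]≔ true
      ; pend = pend s [ t ]≔ true
      ; ovrl = ovrl s [ t ]≔ nonEmpty (wrts s)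
      ; posv = posv s [ t ]≔ (⁅ stor s ⁆ ∪ recOfWriters s) }

    ufr : Status σ r → Thr σ → Status σ r
    ufr s t = record s { rds = rds s [ t ]≔ false }

    usw : Status σ r → Thr σ → Dom σ r → Status σ r
    usw s t d = record s
      { wrts = wrts s [ t ]≔ true
      ; pend = pend s [ t ]≔ true
      ; rec  = rec s [ t ]≔ d
      ; ovrl = tabulate (λ t' → if ⌊ t' ≟ t ⌋ then nonEmpty (wrts s) else true)
      ; posv = tabulate (λ t' → if ⌊ t' ≟ t ⌋ then lookup (posv s) t'
                                 else (lookup (posv s) t' ∪ ⁅ d ⁆)) }

    ufw : Status σ r → Thr σ → Dom σ r → Status σ r
    ufw s t d = record s { stor = d ; wrts = wrts s [ t ]≔ false }

    uor : Status σ r → Thr σ → Status σ r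
    uor s t = record s { pend = pend s [ t ]≔ false ; rec = rec s [ t ]≔ stor s }

    uow : Status σ r → Thr σ → Dom σ r → Status σ r
    uow s t d = record s { stor = d ; pend = pend s [ t ]≔ false }

  data RegTrans (r : Reg σ) : Kind → Status σ r → Action σ → Status σ r → Set where
    t-sr : ∀ {k s t} → lookup (rds s) t ≡ false → lookup (wrts s) t ≡ false →
           RegTrans r k s (sr t r) (usr s t)
    t-sw : ∀ {k s t} d → lookup (rds s) t ≡ false → lookup (wrts s) t ≡ false →
           RegTrans r k s (sw t r d) (usw s t d)
    s-fr-no : ∀ {s t} → lookup (rds s) t ≡ true → lookup (ovrl s) t ≡ false →
              RegTrans r safe s (fr t r (stor s)) (ufr s t)
    s-fr-ov : ∀ {s t} d → lookup (rds s) t ≡ true → lookup (ovrl s) t ≡ true →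
              RegTrans r safe s (fr t r d) (ufr s t)
    s-fw-no : ∀ {s t} → lookup (wrts s) t ≡ true → lookup (ovrl s) t ≡ false →
              RegTrans r safe s (fw t r) (ufw s t (lookup (rec s) t))
    s-fw-ov : ∀ {s t} d → lookup (wrts s) t ≡ true → lookup (ovrl s) t ≡ true →
              RegTrans r safe s (fw t r) (ufw s t d)
    r-fr : ∀ {s t} d → lookup (rds s) t ≡ true → lookup (lookup (posv s) t) d ≡ true →
           RegTrans r regular s (fr t r d) (ufr s t)
    r-ow : ∀ {s t} → lookup (wrts s) t ≡ true → lookup (pend s) t ≡ true →
           RegTrans r regular s (ow t r) (uow s t (lookup (rec s) t))
    r-fw : ∀ {s t} → lookup (wrts s) t ≡ true → lookup (pend s) t ≡ false →
           RegTrans r regular s (fw t r) (ufw s t (stor s))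
    a-or : ∀ {s t} → lookup (rds s) t ≡ true → lookup (pend s) t ≡ true →
           RegTrans r atomic s (or t r) (uor s t)
    a-ow : ∀ {s t} → lookup (wrts s) t ≡ true → lookup (pend s) t ≡ true →
           RegTrans r atomic s (ow t r) (uow s t (lookup (rec s) t))
    a-fr : ∀ {s t} → lookup (rds s) t ≡ true → lookup (pend s) t ≡ false →
           RegTrans r atomic s (fr t r (lookup (rec s) t)) (ufr s t)
    a-fw : ∀ {s t} → lookup (wrts s) t ≡ true → lookup (pend s) t ≡ false →
           RegTrans r atomic s (fw t r) (ufw s t (stor s))

record TRModel (σ : Sig) : Set₁ where
  field
    thread : (t : Thr σ) → ThreadLTS σ t
    wf     : (t : Thr σ) → WFThread (thread t)
    kind   : Reg σ → Kind

module _ {σ : Sig} (M : TRModel σ) where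
  open TRModel M

  record MState : Set where
    constructor mstate
    field
      tst : (t : Thr σ) → Fin (ThreadLTS.nS (thread t))
      rst : (r : Reg σ) → Status σ r
  open MState public

  Step : MState → Action σ → MState → Set
  Step s a s' =
    (∀ t → (InTAct t a → ThreadLTS.Trans (thread t) (tst s t) a (tst s' t))
         × (¬ InTAct t a → tst s' t ≡ tst s t))
    × (∀ r → (reg a ≡ just r → RegTrans r (kind r) (rst s r) a (rst s' r))
           × (reg a ≢ just r → rst s' r ≡ rst s r))

  EnabledM : Action σ → MState → Set
  EnabledM a s = ∃[ s' ] Step s a s'

  -- lengths: nothing = infinite path, just n = finite path with n transitions
  StateIdx : Maybe ℕ → ℕ → Set
  StateIdx nothing  i = ⊤
  StateIdx (just n) i = i ≤ n

  StepIdx : Maybe ℕ → ℕ → Set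
  StepIdx nothing  i = ⊤
  StepIdx (just n) i = i < n

  -- a path s₀ a₁ s₁ a₂ … : st i is the i-th state, act i labels the step
  -- from st i to st (suc i)
  record Path : Set where
    field
      len  : Maybe ℕ
      st   : ℕ → MState
      act  : ℕ → Action σ
      step : ∀ i → StepIdx len i → Step (st i) (act i) (st (suc i))
  open Path public

  FromInit : Path → Set
  FromInit π = (∀ t → tst (st π 0) t ≡ ThreadLTS.init (thread t))
             × (∀ r → rst (st π 0) r ≡ initStatus r)

  -- 𝓑-⌣-justness (suffixes are indexed by their first state k)
  Just : (Action σ → Set) → (Action σ → Action σ → Set) → Path → Set
  Just B _⌣_ π = ∀ k → StateIdx (len π) k → ∀ a → ¬ B a → EnabledM a (st π k) →
    ∃[ j ] (k ≤ j × StepIdx (len π) j × ¬ (a ⌣ act π j))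

  -- a is thread-enabled by π: from some state k on, thr(a) performs no
  -- action (so π has finitely many thr(a)-actions and the thr(a)-component
  -- of st π k is end_{thr a}(π)), and a is enabled there in T_{thr a}
  ThreadEnabled : Path → Action σ → Set
  ThreadEnabled π a =
    ∃[ k ] (StateIdx (len π) k
           × (∀ j → k ≤ j → StepIdx (len π) j → thr (act π j) ≢ thr a)
           × ThreadLTS.Enabled (thread (thr a)) a (tst (st π k) (thr a)))

  InfOftenStart : Path → Reg σ → Set
  InfOftenStart π r = ∀ n → ∃[ j ] (n ≤ j × StepIdx (len π) j × InStart r (act π j))

-- With respect to each register r, a reachable thread state is reading r (it enables
-- exactly the fr_{t,r}(d)), writing r (it enables exactly fw_{t,r}) or idle for r, and
-- in every reachable state of M this agrees with t ∈ rds(r) and t ∈ wrts(r).  Hence a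
-- thread that stops in a state enabling a non-start action can always still move: the
-- register completes the pending read or write (via fr/fw, or via or/ow).  Such a move
-- conflicts under ⌣A only with moves of the same thread, while a start action of r
-- conflicts with another thread's action only if that action is in start(r).  Justness
-- therefore forces (a) and (b); conversely, an enabled action whose thread never moves
-- again is thread-enabled (or/ow through the pending fr/fw), so (a) makes it a start
-- action of some r and (b) supplies the conflicting occurrences from start(r).
module Submission where

open import Defs
open import Level using (0ℓ)
open import Axiom.ExcludedMiddle using (ExcludedMiddle)
open import Data.Bool using (Bool; true; false; _∨_; if_then_else_)
open import Data.Empty using (⊥-elim)
open import Data.Fin using (Fin; _≟_)
open import Data.Maybe using (just; nothing)
import Data.Maybe.Properties as Maybeₚ
open import Data.Nat using (ℕ; zero; suc; _≤_; _≤′_; _+_; _≤?_; ≤′-refl; ≤′-step)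
open import Data.Nat.Properties using (≤-refl; ≤-trans; <⇒≤; <⇒≱; ≤⇒≤′; ≤′⇒≤; m≤m+n; m≤n+m)
open import Data.Product using (∃-syntax; _×_; _,_; proj₁; proj₂)
open import Data.Sum using (_⊎_; inj₁; inj₂; [_,_])
open import Data.Unit using (tt)
open import Data.Vec using (lookup)
open import Data.Vec.Properties using (lookup∘tabulate; lookup∘update; lookup∘update′; lookup-replicate)
open import Function using (_∘_; case_of_)
open import Function.Bundles using (_⇔_; mk⇔)
open import Relation.Nullary using (¬_; Dec; yes; no)
open import Relation.Nullary.Decidable using (⌊_⌋; isYes≗does; dec-true; decidable-stable)
open import Relation.Binary.PropositionalEquality hiding ([_])

update : ∀ {n} {A : Fin n → Set} → ((i : Fin n) → A i) → (i : Fin n) → A i → (j : Fin n) → A j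
update f i x j with i ≟ j
... | yes refl = x
... | no _ = f j

module _ {σ : Sig} where

  InTAct⇒thr : ∀ {t} {b : Action σ} → InTAct t b → thr b ≡ t
  InTAct⇒thr {b = sr _ _} e = e
  InTAct⇒thr {b = fr _ _ _} e = e
  InTAct⇒thr {b = sw _ _ _} e = e
  InTAct⇒thr {b = fw _ _} e = e
  InTAct⇒thr {b = loc _ _} e = e

  InTAct? : ∀ t (b : Action σ) → Dec (InTAct t b)
  InTAct? t (sr t′ _) = t′ ≟ t
  InTAct? t (fr t′ _ _) = t′ ≟ t
  InTAct? t (sw t′ _ _) = t′ ≟ t
  InTAct? t (fw t′ _) = t′ ≟ t
  InTAct? t (or _ _) = no λ ()
  InTAct? t (ow _ _) = no λ ()
  InTAct? t (loc t′ _) = t′ ≟ t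

  InStart? : ∀ r (c : Action σ) → Dec (InStart r c)
  InStart? r (sr t r′) with r′ ≟ r
  ... | yes refl = yes (start-sr t)
  ... | no r′≢r = no λ { (start-sr _) → r′≢r refl }
  InStart? r (sw t r′ d) with r′ ≟ r
  ... | yes refl = yes (start-sw t d)
  ... | no r′≢r = no λ { (start-sw _ _) → r′≢r refl }
  InStart? r (fr _ _ _) = no λ ()
  InStart? r (fw _ _) = no λ ()
  InStart? r (or _ _) = no λ ()
  InStart? r (ow _ _) = no λ ()
  InStart? r (loc _ _) = no λ ()

  start-or-nonstart : ∀ (a : Action σ) → (∃[ r ] InStart r a) ⊎ (¬ IsSR a × ¬ IsSW a)
  start-or-nonstart (sr t r) = inj₁ (r , start-sr t)
  start-or-nonstart (sw t r d) = inj₁ (r , start-sw t d)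
  start-or-nonstart (fr _ _ _) = inj₂ ((λ ()) , (λ ()))
  start-or-nonstart (fw _ _) = inj₂ ((λ ()) , (λ ()))
  start-or-nonstart (or _ _) = inj₂ ((λ ()) , (λ ()))
  start-or-nonstart (ow _ _) = inj₂ ((λ ()) , (λ ()))
  start-or-nonstart (loc _ _) = inj₂ ((λ ()) , (λ ()))

  start⇒InTAct : ∀ {r} {a : Action σ} → InStart r a → InTAct (thr a) a
  start⇒InTAct (start-sr _) = refl
  start⇒InTAct (start-sw _ _) = refl

  start⇒¬local : ∀ {r} {a : Action σ} → InStart r a → ¬ IsLocal a
  start⇒¬local (start-sr _) ()
  start⇒¬local (start-sw _ _) ()

  reg-start : ∀ {r} {a : Action σ} → InStart r a → reg a ≡ just r
  reg-start (start-sr _) = refl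
  reg-start (start-sw _ _) = refl

  sr-start : ∀ {r} (c : Action σ) → IsSR c → reg c ≡ just r → InStart r c
  sr-start (sr t _) _ refl = start-sr t

  sw-start : ∀ {r} (c : Action σ) → IsSW c → reg c ≡ just r → InStart r c
  sw-start (sw t _ d) _ refl = start-sw t d

  same-thread⇒¬⌣A : {a c : Action σ} → thr a ≡ thr c → ¬ a ⌣A c
  same-thread⇒¬⌣A a≡c (((a≢c , _) , _) , _) = a≢c a≡c

  ¬⌣A⇒same-thread : {b c : Action σ} → ¬ IsSR b → ¬ IsSW b → ¬ b ⌣A c → thr b ≡ thr c
  ¬⌣A⇒same-thread {b} {c} ¬sr ¬sw ¬b⌣c with thr b ≟ thr c
  ... | yes b≡c = b≡c
  ... | no b≢c = ⊥-elim (¬b⌣c (((b≢c , λ (k , _) → [ ¬sr , ¬sw ] k) , λ (k , _) → ¬sw k) , λ (k , _) → ¬sr k))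

  start-¬⌣A : ∀ {r} {a c : Action σ} → InStart r a → InStart r c → ¬ a ⌣A c
  start-¬⌣A (start-sr _) (start-sw _ _) (((_ , ¬S) , _) , _) = ¬S (inj₁ tt , tt , refl)
  start-¬⌣A (start-sw _ _) (start-sw _ _) (((_ , ¬S) , _) , _) = ¬S (inj₂ tt , tt , refl)
  start-¬⌣A (start-sw _ _) (start-sr _) ((_ , ¬I) , _) = ¬I (tt , tt , refl)
  start-¬⌣A (start-sr _) (start-sr _) (_ , ¬A) = ¬A (tt , tt , refl)

  start-⌣A-nonstart : ∀ {r} {a c : Action σ} → InStart r a → thr a ≢ thr c → ¬ InStart r c → a ⌣A c
  start-⌣A-nonstart {r} {a} {c} sa a≢c ¬sc =
    ((a≢c , λ (_ , sw-c , e) → ¬sc (sw-start c sw-c (shared e))) ,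
            λ (_ , sr-c , e) → ¬sc (sr-start c sr-c (shared e))) ,
            λ (_ , sr-c , e) → ¬sc (sr-start c sr-c (shared e))
    where
    shared : reg a ≡ reg c → reg c ≡ just r
    shared e = trans (sym e) (reg-start sa)

  ¬⌣A-start⇒start : ∀ {r} {a c : Action σ} → InStart r a → thr a ≢ thr c → ¬ a ⌣A c → InStart r c
  ¬⌣A-start⇒start sa a≢c ¬a⌣c = decidable-stable (InStart? _ _) (λ ¬sc → ¬a⌣c (start-⌣A-nonstart sa a≢c ¬sc))

_⊆_ : ∀ {n} → Subset n → Subset n → Set
p ⊆ q = ∀ i → lookup p i ≡ true → lookup q i ≡ true

Nonempty : ∀ {n} → Subset n → Set
Nonempty p = ∃[ i ] lookup p i ≡ true

⊆-∪ˡ : ∀ {n} (p q : Subset n) → p ⊆ (p ∪ q)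
⊆-∪ˡ p q i pᵢ = trans (lookup∘tabulate _ i) (cong (_∨ lookup q i) pᵢ)

∈-⁅⁆ : ∀ {n} (i : Fin n) → lookup ⁅ i ⁆ i ≡ true
∈-⁅⁆ i = trans (lookup∘tabulate _ i) (trans (isYes≗does (i ≟ i)) (dec-true (i ≟ i) refl))

module _ {σ : Sig} {r : Reg σ} {k : Kind} where

  private
    St = Status σ r

  sr-status : ∀ {st st′ : St} {t′ : Thr σ} {r′ : Reg σ} → RegTrans r k st (sr t′ r′) st′ →
    lookup (rds st′) t′ ≡ true × lookup (wrts st′) t′ ≡ false × Nonempty (lookup (posv st′) t′)
  sr-status {st} {t′ = t} (t-sr _ wr) =
    lookup∘update t (rds st) true , wr ,
    stor st , trans (cong (λ p → lookup p (stor st)) (lookup∘update t (posv st) _))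
                    (⊆-∪ˡ ⁅ stor st ⁆ (recOfWriters st) (stor st) (∈-⁅⁆ (stor st)))

  sw-status : ∀ {st st′ : St} {t′ : Thr σ} {r′ : Reg σ} {d} → RegTrans r k st (sw t′ r′ d) st′ →
    lookup (rds st′) t′ ≡ false × lookup (wrts st′) t′ ≡ true
  sw-status {st} {t′ = t} (t-sw _ rd _) = rd , lookup∘update t (wrts st) true

  fr-status : ∀ {st st′ : St} {t′ : Thr σ} {r′ : Reg σ} {d} → RegTrans r k st (fr t′ r′ d) st′ →
    lookup (rds st′) t′ ≡ false × lookup (wrts st′) t′ ≡ lookup (wrts st) t′
  fr-status {st} {t′ = t} (s-fr-no _ _) = lookup∘update t (rds st) false , refl
  fr-status {st} {t′ = t} (s-fr-ov _ _ _) = lookup∘update t (rds st) false , refl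
  fr-status {st} {t′ = t} (r-fr _ _ _) = lookup∘update t (rds st) false , refl
  fr-status {st} {t′ = t} (a-fr _ _) = lookup∘update t (rds st) false , refl

  fw-status : ∀ {st st′ : St} {t′ : Thr σ} {r′ : Reg σ} → RegTrans r k st (fw t′ r′) st′ →
    lookup (wrts st′) t′ ≡ false × lookup (rds st′) t′ ≡ lookup (rds st) t′
  fw-status {st} {t′ = t} (s-fw-no _ _) = lookup∘update t (wrts st) false , refl
  fw-status {st} {t′ = t} (s-fw-ov _ _ _) = lookup∘update t (wrts st) false , refl
  fw-status {st} {t′ = t} (r-fw _ _) = lookup∘update t (wrts st) false , refl
  fw-status {st} {t′ = t} (a-fw _ _) = lookup∘update t (wrts st) false , refl

  or-status : ∀ {st st′ : St} {t′ : Thr σ} {r′ : Reg σ} → RegTrans r k st (or t′ r′) st′ →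
    lookup (rds st) t′ ≡ true
  or-status (a-or rd _) = rd

  ow-status : ∀ {st st′ : St} {t′ : Thr σ} {r′ : Reg σ} → RegTrans r k st (ow t′ r′) st′ →
    lookup (wrts st) t′ ≡ true
  ow-status (r-ow wr _) = wr
  ow-status (a-ow wr _) = wr

  other-thread-status : ∀ {st st′ : St} {b} (t : Thr σ) → ¬ InTAct t b → RegTrans r k st b st′ →
    lookup (rds st′) t ≡ lookup (rds st) t × lookup (wrts st′) t ≡ lookup (wrts st) t ×
    lookup (posv st) t ⊆ lookup (posv st′) t
  other-thread-status {st} t ¬it (t-sr _ _) =
    lookup∘update′ (¬it ∘ sym) (rds st) true , refl ,
    λ i p → trans (cong (λ q → lookup q i) (lookup∘update′ (¬it ∘ sym) (posv st) _)) p
  other-thread-status {st} t ¬it (t-sw {t = t₀} d _ _) =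
    refl , lookup∘update′ (¬it ∘ sym) (wrts st) true ,
    λ i p → trans (cong (λ q → lookup q i) (lookup∘tabulate _ t)) (grows i p)
    where
    grows : lookup (posv st) t ⊆ (if ⌊ t ≟ t₀ ⌋ then lookup (posv st) t else (lookup (posv st) t ∪ ⁅ d ⁆))
    grows with t ≟ t₀
    ... | yes t≡t₀ = ⊥-elim (¬it (sym t≡t₀))
    ... | no _ = ⊆-∪ˡ (lookup (posv st) t) ⁅ d ⁆
  other-thread-status {st} t ¬it (s-fr-no _ _) = lookup∘update′ (¬it ∘ sym) (rds st) false , refl , λ _ p → p
  other-thread-status {st} t ¬it (s-fr-ov _ _ _) = lookup∘update′ (¬it ∘ sym) (rds st) false , refl , λ _ p → p
  other-thread-status {st} t ¬it (r-fr _ _ _) = lookup∘update′ (¬it ∘ sym) (rds st) false , refl , λ _ p → p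
  other-thread-status {st} t ¬it (a-fr _ _) = lookup∘update′ (¬it ∘ sym) (rds st) false , refl , λ _ p → p
  other-thread-status {st} t ¬it (s-fw-no _ _) = refl , lookup∘update′ (¬it ∘ sym) (wrts st) false , λ _ p → p
  other-thread-status {st} t ¬it (s-fw-ov _ _ _) = refl , lookup∘update′ (¬it ∘ sym) (wrts st) false , λ _ p → p
  other-thread-status {st} t ¬it (r-fw _ _) = refl , lookup∘update′ (¬it ∘ sym) (wrts st) false , λ _ p → p
  other-thread-status {st} t ¬it (a-fw _ _) = refl , lookup∘update′ (¬it ∘ sym) (wrts st) false , λ _ p → p
  other-thread-status t ¬it (r-ow _ _) = refl , refl , λ _ p → p
  other-thread-status t ¬it (a-or _ _) = refl , refl , λ _ p → p
  other-thread-status t ¬it (a-ow _ _) = refl , refl , λ _ p → p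

module _ {σ : Sig} {r : Reg σ} where

  read-progress : ∀ k (st : Status σ r) t → lookup (rds st) t ≡ true → Nonempty (lookup (posv st) t) →
    (∃[ d ] ∃[ st′ ] RegTrans r k st (fr t r d) st′) ⊎ (∃[ st′ ] RegTrans r k st (or t r) st′)
  read-progress safe st t rd _ with lookup (ovrl st) t in e
  ... | false = inj₁ (_ , _ , s-fr-no rd e)
  ... | true = inj₁ (_ , _ , s-fr-ov (stor st) rd e)
  read-progress regular st t rd (d , d∈posv) = inj₁ (_ , _ , r-fr d rd d∈posv)
  read-progress atomic st t rd _ with lookup (pend st) t in e
  ... | true = inj₂ (_ , a-or rd e)
  ... | false = inj₁ (_ , _ , a-fr rd e)

  write-progress : ∀ k (st : Status σ r) t → lookup (wrts st) t ≡ true →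
    (∃[ st′ ] RegTrans r k st (fw t r) st′) ⊎ (∃[ st′ ] RegTrans r k st (ow t r) st′)
  write-progress safe st t wr with lookup (ovrl st) t in e
  ... | false = inj₁ (_ , s-fw-no wr e)
  ... | true = inj₁ (_ , s-fw-ov (stor st) wr e)
  write-progress regular st t wr with lookup (pend st) t in e
  ... | true = inj₂ (_ , r-ow wr e)
  ... | false = inj₁ (_ , r-fw wr e)
  write-progress atomic st t wr with lookup (pend st) t in e
  ... | true = inj₂ (_ , a-ow wr e)
  ... | false = inj₁ (_ , a-fw wr e)

module _ {σ : Sig} {t : Thr σ} (T : ThreadLTS σ t) where
  open ThreadLTS T

  data Phase (r : Reg σ) (x : Fin nS) (pv : Subset (Sig.dom σ r)) : Bool → Bool → Set where
    reading : (∀ a → Enabled a x → ∃[ d ] a ≡ fr t r d) → (∀ d → Enabled (fr t r d) x) →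
              Nonempty pv → Phase r x pv true false
    writing : (∀ a → Enabled a x → a ≡ fw t r) → Enabled (fw t r) x → Phase r x pv false true
    idle : (∀ d → ¬ Enabled (fr t r d) x) → ¬ Enabled (fw t r) x → Phase r x pv false false

  PhaseOf : (r : Reg σ) → Fin nS → Status σ r → Set
  PhaseOf r x st = Phase r x (lookup (posv st) t) (lookup (rds st) t) (lookup (wrts st) t)

  module _ {r : Reg σ} {x : Fin nS} {pv : Subset (Sig.dom σ r)} {rd wr : Bool} where

    reading′ : rd ≡ true → wr ≡ false → (∀ a → Enabled a x → ∃[ d ] a ≡ fr t r d) →
               (∀ d → Enabled (fr t r d) x) → Nonempty pv → Phase r x pv rd wr
    reading′ refl refl = reading

    writing′ : rd ≡ false → wr ≡ true → (∀ a → Enabled a x → a ≡ fw t r) →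
               Enabled (fw t r) x → Phase r x pv rd wr
    writing′ refl refl = writing

    idle′ : rd ≡ false → wr ≡ false → (∀ d → ¬ Enabled (fr t r d) x) → ¬ Enabled (fw t r) x →
            Phase r x pv rd wr
    idle′ refl refl = idle

    fr-enabled⇒reading : ∀ {d} → Phase r x pv rd wr → Enabled (fr t r d) x → rd ≡ true × wr ≡ false
    fr-enabled⇒reading (reading _ _ _) _ = refl , refl
    fr-enabled⇒reading (writing only _) en with only _ en
    ... | ()
    fr-enabled⇒reading (idle ¬fr _) en = ⊥-elim (¬fr _ en)

    fw-enabled⇒writing : Phase r x pv rd wr → Enabled (fw t r) x → rd ≡ false × wr ≡ true
    fw-enabled⇒writing (reading only _ _) en with only _ en
    ... | _ , ()
    fw-enabled⇒writing (writing _ _) _ = refl , refl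
    fw-enabled⇒writing (idle _ ¬fw) en = ⊥-elim (¬fw en)

    other-enabled⇒idle : ∀ {b} → Phase r x pv rd wr → Enabled b x →
      (∀ d → b ≢ fr t r d) → b ≢ fw t r → rd ≡ false × wr ≡ false
    other-enabled⇒idle (reading only _ _) en b≢fr _ = let (d , b≡fr) = only _ en in ⊥-elim (b≢fr d b≡fr)
    other-enabled⇒idle (writing only _) en _ b≢fw = ⊥-elim (b≢fw (only _ en))
    other-enabled⇒idle (idle _ _) _ _ _ = refl , refl

    reading⇒fr-enabled : Phase r x pv rd wr → rd ≡ true → ∀ d → Enabled (fr t r d) x
    reading⇒fr-enabled (reading _ all _) _ = all

    reading⇒posv : Phase r x pv rd wr → rd ≡ true → Nonempty pv
    reading⇒posv (reading _ _ posv≠∅) _ = posv≠∅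

    writing⇒fw-enabled : Phase r x pv rd wr → wr ≡ true → Enabled (fw t r) x
    writing⇒fw-enabled (writing _ en) _ = en

  phase-transport : ∀ {r x pv pv′ rd rd′ wr wr′} → rd′ ≡ rd → wr′ ≡ wr → pv ⊆ pv′ →
    Phase r x pv rd wr → Phase r x pv′ rd′ wr′
  phase-transport refl refl pv⊆pv′ (reading only all (d , d∈pv)) = reading only all (d , pv⊆pv′ d d∈pv)
  phase-transport refl refl _ (writing only en) = writing only en
  phase-transport refl refl _ (idle ¬fr ¬fw) = idle ¬fr ¬fw

  module _ (wf : WFThread T) where
    open WFThread wf

    idle-after : ∀ {x b x′ r} → Reach x → Trans x b x′ → b ≢ sr t r → (∀ d → b ≢ sw t r d) →
      (∀ d → ¬ Enabled (fr t r d) x′) × ¬ Enabled (fw t r) x′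
    idle-after R tr b≢sr b≢sw =
      (λ d en → b≢sr (fr-only _ d R tr en)) , (λ en → let (d , b≡sw) = fw-only _ R tr en in b≢sw d b≡sw)

    phase-idle-after : ∀ {x b x′ r} {st : Status σ r} → Reach x → Trans x b x′ → reg b ≢ just r →
      PhaseOf r x st → PhaseOf r x′ st
    phase-idle-after R tr b∉r ph =
      let (rd , wr) = other-enabled⇒idle ph (_ , tr) (λ _ → b∉r ∘ cong reg) (b∉r ∘ cong reg)
          (¬fr , ¬fw) = idle-after R tr (b∉r ∘ cong reg) (λ _ → b∉r ∘ cong reg)
      in idle′ rd wr ¬fr ¬fw

    own-register-phase : ∀ {k x b x′ r} {st st′ : Status σ r} → Reach x → Trans x b x′ → InTAct t b →
      reg b ≡ just r → RegTrans r k st b st′ → PhaseOf r x st → PhaseOf r x′ st′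
    own-register-phase {b = sr _ _} R tr refl refl rt _ =
      let (rd , wr , posv≠∅) = sr-status rt in
      reading′ rd wr (λ a → proj₁ (after-sr _ R tr a)) (λ d → proj₂ (after-sr _ R tr _) d refl) posv≠∅
    own-register-phase {b = sw _ _ _} R tr refl refl rt _ =
      let (rd , wr) = sw-status rt in
      writing′ rd wr (λ a → proj₁ (after-sw _ _ R tr a)) (proj₂ (after-sw _ _ R tr _) refl)
    own-register-phase {b = fr _ _ _} R tr refl refl rt ph =
      let (rd , wr≡) = fr-status rt
          (_ , wr) = fr-enabled⇒reading ph (_ , tr)
          (¬fr , ¬fw) = idle-after R tr (λ ()) (λ _ ())
      in idle′ rd (trans wr≡ wr) ¬fr ¬fw
    own-register-phase {b = fw _ _} R tr refl refl rt ph =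
      let (wr , rd≡) = fw-status rt
          (rd , _) = fw-enabled⇒writing ph (_ , tr)
          (¬fr , ¬fw) = idle-after R tr (λ ()) (λ _ ())
      in idle′ (trans rd≡ rd) wr ¬fr ¬fw

  bystander-phase : ∀ {k x b r} {st st′ : Status σ r} → ¬ InTAct t b → RegTrans r k st b st′ →
    PhaseOf r x st → PhaseOf r x st′
  bystander-phase ¬it rt = let (rd , wr , posv⊆) = other-thread-status t ¬it rt in phase-transport rd wr posv⊆

module Composition {σ : Sig} (M : TRModel σ) where
  open TRModel M

  private
    NS : Thr σ → ℕ
    NS t = ThreadLTS.nS (thread t)

    En : ∀ t → Action σ → Fin (NS t) → Set
    En t = ThreadLTS.Enabled (thread t)

    Tr : ∀ t → Fin (NS t) → Action σ → Fin (NS t) → Set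
    Tr t = ThreadLTS.Trans (thread t)

    Reachable : ∀ t → Fin (NS t) → Set
    Reachable t = ThreadLTS.Reach (thread t)

  PhaseAt : MState M → Thr σ → Reg σ → Set
  PhaseAt s t r = PhaseOf (thread t) r (tst s t) (rst s r)

  ThreadCoherent : MState M → Thr σ → Set
  ThreadCoherent s t = Reachable t (tst s t) × ∀ r → PhaseAt s t r

  Coherent : MState M → Set
  Coherent s = ∀ t → ThreadCoherent s t

  initial-coherent : ∀ {s} → (∀ t → tst s t ≡ ThreadLTS.init (thread t)) → (∀ r → rst s r ≡ initStatus r) →
    Coherent s
  initial-coherent {s} tst₀ rst₀ t =
    subst (Reachable t) (sym (tst₀ t)) ThreadLTS.reach-init ,
    λ r → idle′ (thread t) (rds₀ r) (wrts₀ r)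
      (λ d en → WFThread.fr-init (wf t) r d (subst (En t _) (tst₀ t) en))
      (λ en → WFThread.fw-init (wf t) r (subst (En t _) (tst₀ t) en))
    where
    rds₀ : ∀ r → lookup (rds (rst s r)) t ≡ false
    rds₀ r = trans (cong (λ st → lookup (rds st) t) (rst₀ r)) (lookup-replicate t false)
    wrts₀ : ∀ r → lookup (wrts (rst s r)) t ≡ false
    wrts₀ r = trans (cong (λ st → lookup (wrts st) t) (rst₀ r)) (lookup-replicate t false)

  bystander-coherent : ∀ {s b s′ t} → ThreadCoherent s t → Step M s b s′ → ¬ InTAct t b → ThreadCoherent s′ t
  bystander-coherent {s} {b} {s′} {t} (R , ph) (ths , rgs) ¬it =
    subst (Reachable t) (sym x≡) R ,
    λ r → subst (λ x → PhaseOf (thread t) r x (rst s′ r)) (sym x≡) (new r)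
    where
    x≡ : tst s′ t ≡ tst s t
    x≡ = proj₂ (ths t) ¬it
    new : ∀ r → PhaseOf (thread t) r (tst s t) (rst s′ r)
    new r with Maybeₚ.≡-dec _≟_ (reg b) (just r)
    ... | yes b∈r = bystander-phase (thread t) ¬it (proj₁ (rgs r) b∈r) (ph r)
    ... | no b∉r = subst (PhaseOf (thread t) r (tst s t)) (sym (proj₂ (rgs r) b∉r)) (ph r)

  mover-coherent : ∀ {s b s′ t} → ThreadCoherent s t → Step M s b s′ → InTAct t b → ThreadCoherent s′ t
  mover-coherent {s} {b} {s′} {t} (R , ph) (ths , rgs) it = ThreadLTS.reach-step R tr , new
    where
    tr : Tr t (tst s t) b (tst s′ t)
    tr = proj₁ (ths t) it
    new : ∀ r → PhaseAt s′ t r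
    new r with Maybeₚ.≡-dec _≟_ (reg b) (just r)
    ... | yes b∈r = own-register-phase (thread t) (wf t) R tr it b∈r (proj₁ (rgs r) b∈r) (ph r)
    ... | no b∉r = subst (PhaseOf (thread t) r (tst s′ t)) (sym (proj₂ (rgs r) b∉r))
                     (phase-idle-after (thread t) (wf t) {st = rst s r} R tr b∉r (ph r))

  step-coherent : ∀ {s b s′} → Coherent s → Step M s b s′ → Coherent s′
  step-coherent {b = b} coh stp t with InTAct? t b
  ... | yes it = mover-coherent (coh t) stp it
  ... | no ¬it = bystander-coherent (coh t) stp ¬it

  record ThreadsStep (s : MState M) (b : Action σ) (f : (t : Thr σ) → Fin (NS t)) : Set where
    constructor threads-step
    field thread-step : ∀ t → (InTAct t b → Tr t (tst s t) b (f t)) × (¬ InTAct t b → f t ≡ tst s t)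

  record RegistersStep (s : MState M) (b : Action σ) (g : (r : Reg σ) → Status σ r) : Set where
    constructor registers-step
    field register-step : ∀ r → (reg b ≡ just r → RegTrans r (kind r) (rst s r) b (g r))
                              × (reg b ≢ just r → g r ≡ rst s r)

  thread-moves : ∀ {s b t x} → InTAct t b → Tr t (tst s t) b x → ThreadsStep s b (update (tst s) t x)
  thread-moves {s} {b} {t} {x} it tr = threads-step moves
    where
    moves : ∀ t′ → (InTAct t′ b → Tr t′ (tst s t′) b (update (tst s) t x t′))
                 × (¬ InTAct t′ b → update (tst s) t x t′ ≡ tst s t′)
    moves t′ with t ≟ t′
    ... | yes refl = (λ _ → tr) , (λ ¬it → ⊥-elim (¬it it))
    ... | no t≢t′ = (λ it′ → ⊥-elim (t≢t′ (trans (sym (InTAct⇒thr it)) (InTAct⇒thr it′)))) , (λ _ → refl)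

  threads-stay : ∀ {s b} → (∀ t → ¬ InTAct t b) → ThreadsStep s b (tst s)
  threads-stay ¬it = threads-step λ t → (λ it → ⊥-elim (¬it t it)) , (λ _ → refl)

  register-moves : ∀ {s b r y} → reg b ≡ just r → RegTrans r (kind r) (rst s r) b y →
    RegistersStep s b (update (rst s) r y)
  register-moves {s} {b} {r} {y} b∈r rt = registers-step moves
    where
    moves : ∀ r′ → (reg b ≡ just r′ → RegTrans r′ (kind r′) (rst s r′) b (update (rst s) r y r′))
                 × (reg b ≢ just r′ → update (rst s) r y r′ ≡ rst s r′)
    moves r′ with r ≟ r′
    ... | yes refl = (λ _ → rt) , (λ b∉r → ⊥-elim (b∉r b∈r))
    ... | no r≢r′ = (λ b∈r′ → ⊥-elim (r≢r′ (Maybeₚ.just-injective (trans (sym b∈r) b∈r′)))) , (λ _ → refl)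

  registers-stay : ∀ {s b} → reg b ≡ nothing → RegistersStep s b (rst s)
  registers-stay b-local = registers-step λ r → (λ b∈r → case trans (sym b-local) b∈r of λ ()) , (λ _ → refl)

  enabled : ∀ {s b f g} → ThreadsStep s b f → RegistersStep s b g → EnabledM M b s
  enabled (threads-step ths) (registers-step rgs) = mstate _ _ , ths , rgs

  thread-enabled : ∀ {s a t} → EnabledM M a s → InTAct t a → En t a (tst s t)
  thread-enabled {t = t} (s′ , ths , _) it = tst s′ t , proj₁ (ths t) it

  RegisterMove : MState M → Thr σ → Set
  RegisterMove s t = ∃[ b ] (thr b ≡ t × ¬ IsSR b × ¬ IsSW b × ¬ IsLocal b × EnabledM M b s)

  complete-read : ∀ {s t r} → Coherent s → lookup (rds (rst s r)) t ≡ true → RegisterMove s t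
  complete-read {s} {t} {r} coh rd
    with read-progress (kind r) (rst s r) t rd (reading⇒posv (thread t) (proj₂ (coh t) r) rd)
  ... | inj₁ (d , _ , rt) = fr t r d , refl , (λ ()) , (λ ()) , (λ ()) ,
    enabled (thread-moves refl (proj₂ (reading⇒fr-enabled (thread t) (proj₂ (coh t) r) rd d)))
            (register-moves refl rt)
  ... | inj₂ (_ , rt) = or t r , refl , (λ ()) , (λ ()) , (λ ()) ,
    enabled (threads-stay (λ _ ())) (register-moves refl rt)

  complete-write : ∀ {s t r} → Coherent s → lookup (wrts (rst s r)) t ≡ true → RegisterMove s t
  complete-write {s} {t} {r} coh wr with write-progress (kind r) (rst s r) t wr
  ... | inj₁ (_ , rt) = fw t r , refl , (λ ()) , (λ ()) , (λ ()) ,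
    enabled (thread-moves refl (proj₂ (writing⇒fw-enabled (thread t) (proj₂ (coh t) r) wr)))
            (register-moves refl rt)
  ... | inj₂ (_ , rt) = ow t r , refl , (λ ()) , (λ ()) , (λ ()) ,
    enabled (threads-stay (λ _ ())) (register-moves refl rt)

  start-enabled : ∀ {s r a} → Coherent s → InStart r a → En (thr a) a (tst s (thr a)) → EnabledM M a s
  start-enabled {r = r} coh (start-sr t) en =
    let (rd , wr) = other-enabled⇒idle (thread t) (proj₂ (coh t) r) en (λ _ ()) (λ ())
    in enabled (thread-moves refl (proj₂ en)) (register-moves refl (t-sr rd wr))
  start-enabled {r = r} coh (start-sw t d) en =
    let (rd , wr) = other-enabled⇒idle (thread t) (proj₂ (coh t) r) en (λ _ ()) (λ ())
    in enabled (thread-moves refl (proj₂ en)) (register-moves refl (t-sw d rd wr))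

  module _ (B : Action σ → Set) (B⊆local : ∀ a → B a → IsLocal a) where

    nonlocal : ∀ {s t} → RegisterMove s t → ∃[ b ] (thr b ≡ t × ¬ IsSR b × ¬ IsSW b × ¬ B b × EnabledM M b s)
    nonlocal (b , b∈t , ¬sr , ¬sw , ¬loc , en) = b , b∈t , ¬sr , ¬sw , ¬loc ∘ B⊆local b , en

    progress : ∀ {s} → Coherent s → ∀ a → ¬ IsSR a → ¬ IsSW a → ¬ B a → En (thr a) a (tst s (thr a)) →
      ∃[ b ] (thr b ≡ thr a × ¬ IsSR b × ¬ IsSW b × ¬ B b × EnabledM M b s)
    progress coh (sr _ _) ¬sr _ _ _ = ⊥-elim (¬sr tt)
    progress coh (sw _ _ _) _ ¬sw _ _ = ⊥-elim (¬sw tt)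
    progress coh (or t _) _ _ _ (_ , tr) = ⊥-elim (ThreadLTS.trans-act (thread t) tr)
    progress coh (ow t _) _ _ _ (_ , tr) = ⊥-elim (ThreadLTS.trans-act (thread t) tr)
    progress coh (loc t i) _ _ ¬Ba (_ , tr) =
      loc t i , refl , (λ ()) , (λ ()) , ¬Ba , enabled (thread-moves refl tr) (registers-stay refl)
    progress coh (fr t r d) _ _ _ en =
      nonlocal (complete-read coh (proj₁ (fr-enabled⇒reading (thread t) (proj₂ (coh t) r) en)))
    progress coh (fw t r) _ _ _ en =
      nonlocal (complete-write coh (proj₂ (fw-enabled⇒writing (thread t) (proj₂ (coh t) r) en)))

    enabled⇒thread-witness : ∀ {s} → Coherent s → ∀ a → ¬ B a → EnabledM M a s →
      ∃[ a′ ] (thr a′ ≡ thr a × ¬ B a′ × En (thr a′) a′ (tst s (thr a′)) × (∀ r → InStart r a′ → InStart r a))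
    enabled⇒thread-witness coh a@(sr _ _) ¬Ba en = a , refl , ¬Ba , thread-enabled en refl , λ _ sa → sa
    enabled⇒thread-witness coh a@(sw _ _ _) ¬Ba en = a , refl , ¬Ba , thread-enabled en refl , λ _ sa → sa
    enabled⇒thread-witness coh a@(fr _ _ _) ¬Ba en = a , refl , ¬Ba , thread-enabled en refl , λ _ sa → sa
    enabled⇒thread-witness coh a@(fw _ _) ¬Ba en = a , refl , ¬Ba , thread-enabled en refl , λ _ sa → sa
    enabled⇒thread-witness coh a@(loc _ _) ¬Ba en = a , refl , ¬Ba , thread-enabled en refl , λ _ sa → sa
    enabled⇒thread-witness coh (or t r) _ (_ , _ , rgs) =
      fr t r (Sig.d0 σ r) , refl , B⊆local _ ,
      reading⇒fr-enabled (thread t) (proj₂ (coh t) r) (or-status (proj₁ (rgs r) refl)) _ , λ _ ()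
    enabled⇒thread-witness coh (ow t r) _ (_ , _ , rgs) =
      fw t r , refl , B⊆local _ ,
      writing⇒fw-enabled (thread t) (proj₂ (coh t) r) (ow-status (proj₁ (rgs r) refl)) , λ _ ()

module _ {σ : Sig} {M : TRModel σ} where
  open Composition M

  state-idx : ∀ {l i} → StepIdx M l i → StateIdx M l i
  state-idx {nothing} _ = tt
  state-idx {just _} i<n = <⇒≤ i<n

  step-idx : ∀ {l i} → StateIdx M l (suc i) → StepIdx M l i
  step-idx {nothing} _ = tt
  step-idx {just _} i<n = i<n

  late-index : ∀ l k n → StateIdx M l k →
    ∃[ m ] (k ≤ m × StateIdx M l m × (n ≤ m ⊎ (∀ j → m ≤ j → ¬ StepIdx M l j)))
  late-index nothing k n _ = n + k , m≤n+m k n , tt , inj₁ (m≤m+n n k)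
  late-index (just L) k n k≤L with n + k ≤? L
  ... | yes n+k≤L = n + k , m≤n+m k n , n+k≤L , inj₁ (m≤m+n n k)
  ... | no _ = L , k≤L , ≤-refl , inj₂ (λ j L≤j j<L → <⇒≱ j<L L≤j)

  module _ (π : Path M) where

    Quiet : Thr σ → ℕ → Set
    Quiet t k = ∀ j → k ≤ j → StepIdx M (len π) j → thr (act π j) ≢ t

    quiet-frozen : ∀ {t k m} → Quiet t k → k ≤ m → StateIdx M (len π) m → tst (st π m) t ≡ tst (st π k) t
    quiet-frozen {t} {k} quiet k≤m = frozen (≤⇒≤′ k≤m)
      where
      frozen : ∀ {m} → k ≤′ m → StateIdx M (len π) m → tst (st π m) t ≡ tst (st π k) t
      frozen ≤′-refl _ = refl
      frozen (≤′-step {m} k≤′m) idx =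
        trans (proj₂ (proj₁ (step π m (step-idx idx)) t) (quiet m (≤′⇒≤ k≤′m) (step-idx idx) ∘ InTAct⇒thr))
              (frozen k≤′m (state-idx (step-idx idx)))

    coherent-at : FromInit M π → ∀ i → StateIdx M (len π) i → Coherent (st π i)
    coherent-at (tst₀ , rst₀) zero _ = initial-coherent tst₀ rst₀
    coherent-at π₀ (suc i) idx =
      step-coherent (coherent-at π₀ i (state-idx (step-idx idx))) (step π i (step-idx idx))

    just⇒conflicts-recur : ∀ {B _⌣_ a k} → Just M B _⌣_ π → ¬ B a → StateIdx M (len π) k →
      (∀ m → k ≤ m → StateIdx M (len π) m → EnabledM M a (st π m)) →
      ∀ n → ∃[ j ] (n ≤ j × StepIdx M (len π) j × ¬ (a ⌣ act π j))
    just⇒conflicts-recur {k = k} J ¬Ba k-idx en n with late-index (len π) k n k-idx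
    ... | m , k≤m , m-idx , late with J m m-idx _ ¬Ba (en m k≤m m-idx) | late
    ...   | j , m≤j , j-idx , ¬a⌣ | inj₁ n≤m = j , ≤-trans n≤m m≤j , j-idx , ¬a⌣
    ...   | j , m≤j , j-idx , _ | inj₂ final = ⊥-elim (final j m≤j j-idx)

module _ {σ : Sig} (M : TRModel σ) (B : Action σ → Set) (B⊆local : ∀ a → B a → IsLocal a)
         (π : Path M) (π₀ : FromInit M π) where
  open Composition M

  just⇒¬threadEnabled-nonstart : Just M B _⌣A_ π → ∀ a → ¬ IsSR a → ¬ IsSW a → ¬ B a → ¬ ThreadEnabled M π a
  just⇒¬threadEnabled-nonstart J a ¬sr ¬sw ¬Ba (k , k-idx , quiet , en) =
    let (b , b∈a , ¬sr-b , ¬sw-b , ¬Bb , en-b) = progress B B⊆local (coherent-at π π₀ k k-idx) a ¬sr ¬sw ¬Ba en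
        (j , k≤j , j-idx , ¬b⌣) = J k k-idx b ¬Bb en-b
    in quiet j k≤j j-idx (trans (sym (¬⌣A⇒same-thread ¬sr-b ¬sw-b ¬b⌣)) b∈a)

  just⇒threadEnabled-start : Just M B _⌣A_ π → ∀ a → ¬ B a → ThreadEnabled M π a → ∃[ r ] InStart r a
  just⇒threadEnabled-start J a ¬Ba te with start-or-nonstart a
  ... | inj₁ start = start
  ... | inj₂ (¬sr , ¬sw) = ⊥-elim (just⇒¬threadEnabled-nonstart J a ¬sr ¬sw ¬Ba te)

  just⇒start-recurs : Just M B _⌣A_ π → ∀ r a → InStart r a → ThreadEnabled M π a → InfOftenStart M π r
  just⇒start-recurs J r a sa (k , k-idx , quiet , en) n =
    let (j , n+k≤j , j-idx , ¬a⌣) =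
          just⇒conflicts-recur π {B = B} {_⌣_ = _⌣A_} J ¬Ba k-idx enabled-from-k (n + k)
    in j , ≤-trans (m≤m+n n k) n+k≤j , j-idx ,
       ¬⌣A-start⇒start sa (λ e → quiet j (≤-trans (m≤n+m k n) n+k≤j) j-idx (sym e)) ¬a⌣
    where
    ¬Ba : ¬ B a
    ¬Ba = start⇒¬local sa ∘ B⊆local a
    enabled-from-k : ∀ m → k ≤ m → StateIdx M (len π) m → EnabledM M a (st π m)
    enabled-from-k m k≤m m-idx =
      start-enabled (coherent-at π π₀ m m-idx) sa
        (subst (ThreadLTS.Enabled (TRModel.thread M (thr a)) a) (sym (quiet-frozen π quiet k≤m m-idx)) en)

  conditions⇒just : ExcludedMiddle 0ℓ →
    (∀ a → ¬ B a → ThreadEnabled M π a → ∃[ r ] InStart r a) →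
    (∀ r a → InStart r a → ThreadEnabled M π a → InfOftenStart M π r) → Just M B _⌣A_ π
  conditions⇒just em nonstart recur k k-idx a ¬Ba en
    -- whether thr a ever moves again is undecidable; this is the only use of excluded middle
    with em {∃[ j ] (k ≤ j × StepIdx M (len π) j × thr (act π j) ≡ thr a)}
  ... | yes (j , k≤j , j-idx , same) = j , k≤j , j-idx , same-thread⇒¬⌣A (sym same)
  ... | no ¬moves =
    let (a′ , a′∈a , ¬Ba′ , en′ , back) = enabled⇒thread-witness B B⊆local (coherent-at π π₀ k k-idx) a ¬Ba en
        (r , sa′) = nonstart a′ ¬Ba′ (k , k-idx , (λ j k≤j j-idx e → quiet j k≤j j-idx (trans e a′∈a)) , en′)
        sa = back r sa′
        (j , k≤j , j-idx , sc) = recur r a sa (k , k-idx , quiet , thread-enabled en (start⇒InTAct sa)) k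
    in j , k≤j , j-idx , start-¬⌣A sa sc
    where
    quiet : Quiet π (thr a) k
    quiet j k≤j j-idx e = ¬moves (j , k≤j , j-idx , e)

proposition19 : ExcludedMiddle 0ℓ →
    (σ : Sig) (M : TRModel σ) (B : Action σ → Set) →
    (∀ a → B a → IsLocal a) →
    (π : Path M) → FromInit M π →
    Just M B _⌣A_ π
      ⇔ ((∀ a → ¬ B a → ThreadEnabled M π a → ∃[ r ] InStart r a)
        × (∀ r a → InStart r a → ThreadEnabled M π a → InfOftenStart M π r))
proposition19 em σ M B B⊆local π π₀ =
  mk⇔ (λ J → just⇒threadEnabled-start M B B⊆local π π₀ J , just⇒start-recurs M B B⊆local π π₀ J)
      (λ (nonstart , recur) → conditions⇒just M B B⊆local π π₀ em nonstart recur)
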